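{- For $n\ge 1$, the number $s_n^1(1234)$ of partial permutations of length $n$ with exactly one hole that avoid $1234$ equals $\binom{2n-2}{n-1}$.
   Context: A partial permutation of length $n$ with one hole is a sequence $\pi_1\cdots\pi_n$ in which each of $1,\dots,n-1$ appears exactly once and the remaining entry is a hole symbol $\diamond$. A permutation $\sigma$ of $[n]$ is an extension of $\pi$ if the standardization (order-preserving relabeling by $1,2,\dots$) of the restriction of $\sigma$ to the non-hole positions equals the restriction of $\pi$ to those positions. $\pi$ avoids a pattern $p$ if every extension of $\pi$ avoids $p$ in the classical sense. -}

module Defs where

open import Data.Nat using (ℕ; zero; suc; _∸_; _<ᵇ_)
open import Data.Bool using (_∧_)
open import Data.Fin using (Fin; toℕ; _<_)
open import Data.Fin.Permutation using (Permutation′; _⟨$⟩ʳ_)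
open import Data.Maybe using (Maybe; just; nothing; is-just)
open import Data.Vec using (Vec; lookup)
open import Data.List using (List; filterᵇ; length; allFin)
open import Data.Product using (Σ; ∃; _×_)
open import Relation.Binary.PropositionalEquality using (_≡_)
open import Relation.Nullary using (¬_)

-- A word of length n over {1,…,n-1} ∪ {◇}: entry (just v) is the letter v+1
-- (0-indexed Fin), entry nothing is the hole symbol ◇.
Word : ℕ → Set
Word n = Vec (Maybe (Fin (n ∸ 1))) n

OccursOnce : ∀ {n} → Word n → Maybe (Fin (n ∸ 1)) → Set
OccursOnce {n} w x = Σ (Fin n) λ i → (lookup w i ≡ x) × (∀ j → lookup w j ≡ x → j ≡ i)

IsPartialPerm1 : ∀ {n} → Word n → Set
IsPartialPerm1 w = OccursOnce w nothing × (∀ v → OccursOnce w (just v))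

-- rank of the value σ(i) among the values of σ at the non-hole positions of w
-- (number of non-hole positions j with σ(j) < σ(i)); this is the value at i of
-- the standardization of σ restricted to the non-hole positions (0-indexed)
rankAmongNonHoles : ∀ {n} → Word n → Permutation′ n → Fin n → ℕ
rankAmongNonHoles {n} w σ i =
  length (filterᵇ (λ j → is-just (lookup w j) ∧ (toℕ (σ ⟨$⟩ʳ j) <ᵇ toℕ (σ ⟨$⟩ʳ i))) (allFin n))

IsExtension : ∀ {n} → Permutation′ n → Word n → Set
IsExtension σ π = ∀ i v → lookup π i ≡ just v → toℕ v ≡ rankAmongNonHoles π σ i

Contains1234 : ∀ {n} → Permutation′ n → Set
Contains1234 {n} σ = Σ (Fin n) λ i → Σ (Fin n) λ j → Σ (Fin n) λ k → Σ (Fin n) λ l →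
  (i < j) × (j < k) × (k < l) ×
  (σ ⟨$⟩ʳ i < σ ⟨$⟩ʳ j) × (σ ⟨$⟩ʳ j < σ ⟨$⟩ʳ k) × (σ ⟨$⟩ʳ k < σ ⟨$⟩ʳ l)

Avoids1234 : ∀ {n} → Word n → Set
Avoids1234 {n} π = (σ : Permutation′ n) → IsExtension σ π → ¬ Contains1234 σ

-- Among four positions of a partial permutation with one hole at most one is the hole,
-- so a 1234 in an extension contains an increasing triple of letters; conversely, wherever
-- the hole lies relative to a 123 of the letters, a suitable value for it completes a 1234.
-- Hence the 1234-avoiders of length n are the n placements of a hole in the 123-avoiding
-- permutations of n - 1, and their number is n · Cat(n - 1) = C(2n - 2, n - 1).  They are
-- enumerated by a generator that writes each word left to right, using that the entries of
-- a 123-avoider that are not left-to-right minima decrease; its counts are ballot numbers.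

module Submission where

open import Data.Bool using (Bool; true; false; if_then_else_; T; _∧_)
open import Data.Empty using (⊥; ⊥-elim)
open import Data.Fin as Fin using (Fin; zero; suc; toℕ; fromℕ<; punchIn; punchOut)
import Data.Fin.Properties as Fin
open import Data.Fin.Permutation using (Permutation′; permutation; _⟨$⟩ʳ_)
open import Data.List as List using (List; []; _∷_; _++_; map; length; [_]; filterᵇ)
open import Data.List.Properties using (length-++; length-map; map-∘; map-id-local)
open import Data.List.Membership.Propositional using (_∈_)
open import Data.List.Membership.Propositional.Properties using (∈-++⁺ˡ; ∈-++⁺ʳ; ∈-++⁻; ∈-map⁺; ∈-map⁻)
open import Data.List.Relation.Unary.All as All using (All; []; _∷_)
import Data.List.Relation.Unary.All.Properties as All
open import Data.List.Relation.Unary.AllPairs using (AllPairs; []; _∷_)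
import Data.List.Relation.Unary.AllPairs.Properties as AllPairs
open import Data.List.Relation.Unary.Any using (here; there)
open import Data.List.Relation.Unary.Unique.Propositional using (Unique)
import Data.List.Relation.Unary.Unique.Propositional.Properties as Unique
open import Data.Maybe as Maybe using (Maybe; just; nothing; is-just)
import Data.Maybe.Properties as Maybe
open import Data.Nat
open import Data.Nat.Properties
open import Algebra.Properties.CommutativeSemigroup +-commutativeSemigroup using (x∙yz≈y∙xz; xy∙z≈x∙zy; interchange)
open import Data.Nat.Combinatorics using (_C_; k>n⇒nCk≡0; nCk+nC[k+1]≡[n+1]C[k+1]; nC1≡n)
open import Data.Nat.Tactic.RingSolver using (solve-∀)
open import Data.Product using (Σ; ∃; ∃₂; _×_; _,_; proj₁; proj₂)
open import Data.Sum using (_⊎_; inj₁; inj₂)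
open import Data.Unit using (⊤; tt)
open import Data.Vec as Vec using (Vec; []; _∷_; head; lookup)
open import Data.Vec.Properties using (∷-injectiveʳ; lookup-map)
open import Function using (_∘_)
open import Function.Bundles using (_⇔_; mk⇔; module Equivalence)
open import Function.Construct.Composition using (_⇔-∘_)
open import Relation.Binary.Definitions using (tri<; tri≈; tri>)
open import Relation.Binary.PropositionalEquality hiding ([_])
open import Relation.Nullary using (¬_; yes; no)
open ≡-Reasoning

open import Defs

ind : Bool → ℕ
ind b = if b then 1 else 0

ind-true : ∀ {b} → T b → ind b ≡ 1
ind-true {true} _ = refl

ind-false : ∀ {b} → ¬ T b → ind b ≡ 0
ind-false {false} _  = refl
ind-false {true}  ¬t = ⊥-elim (¬t tt)

ind-≡ᵇ-refl : ∀ a → ind (a ≡ᵇ a) ≡ 1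
ind-≡ᵇ-refl a = ind-true (≡⇒≡ᵇ a a refl)

ind-≡ᵇ-≢ : ∀ {a b} → a ≢ b → ind (a ≡ᵇ b) ≡ 0
ind-≡ᵇ-≢ {a} {b} a≢b = ind-false (a≢b ∘ ≡ᵇ⇒≡ a b)

ind-≡ᵇ-sym : ∀ a b → ind (a ≡ᵇ b) ≡ ind (b ≡ᵇ a)
ind-≡ᵇ-sym zero    zero    = refl
ind-≡ᵇ-sym zero    (suc b) = refl
ind-≡ᵇ-sym (suc a) zero    = refl
ind-≡ᵇ-sym (suc a) (suc b) = ind-≡ᵇ-sym a b

ind-<ᵇ : ∀ {a b} → a < b → ind (a <ᵇ b) ≡ 1
ind-<ᵇ a<b = ind-true (<⇒<ᵇ a<b)

ind-≮ᵇ : ∀ {a b} → b ≤ a → ind (a <ᵇ b) ≡ 0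
ind-≮ᵇ {a} {b} b≤a = ind-false (λ t → <⇒≱ (<ᵇ⇒< a b t) b≤a)

ind-<ᵇ-suc : ∀ a b → ind (a <ᵇ suc b) ≡ ind (a <ᵇ b) + ind (a ≡ᵇ b)
ind-<ᵇ-suc zero    zero    = refl
ind-<ᵇ-suc zero    (suc b) = refl
ind-<ᵇ-suc (suc a) zero    = refl
ind-<ᵇ-suc (suc a) (suc b) = ind-<ᵇ-suc a b

-- The generator works with ℕ-valued letters; `nothing` is the hole.
ℕWord : ℕ → Set
ℕWord = Vec (Maybe ℕ)

sameLetter : Maybe ℕ → Maybe ℕ → ℕ
sameLetter nothing  nothing  = 1
sameLetter (just a) (just b) = ind (a ≡ᵇ b)
sameLetter _        _        = 0

sameLetter-refl : ∀ x → sameLetter x x ≡ 1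
sameLetter-refl nothing  = refl
sameLetter-refl (just a) = ind-≡ᵇ-refl a

multiplicity : ∀ {k} → Maybe ℕ → ℕWord k → ℕ
multiplicity x []      = 0
multiplicity x (y ∷ u) = sameLetter x y + multiplicity x u

multiplicity-∷-self : ∀ {k} x (u : ℕWord k) → multiplicity x (x ∷ u) ≡ suc (multiplicity x u)
multiplicity-∷-self x u = cong (_+ multiplicity x u) (sameLetter-refl x)

occurrences : ℕ → List ℕ → ℕ
occurrences v []      = 0
occurrences v (s ∷ S) = ind (v ≡ᵇ s) + occurrences v S

occurrences-++ : ∀ v S S′ → occurrences v (S ++ S′) ≡ occurrences v S + occurrences v S′
occurrences-++ v []      S′ = refl
occurrences-++ v (s ∷ S) S′ =
  trans (cong (ind (v ≡ᵇ s) +_) (occurrences-++ v S S′)) (sym (+-assoc (ind (v ≡ᵇ s)) _ _))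

occurrences⇒∈ : ∀ v S → 0 < occurrences v S → v ∈ S
occurrences⇒∈ v (s ∷ S) p with v ≡ᵇ s in eq
... | true  = here (≡ᵇ⇒≡ v s (subst T (sym eq) tt))
... | false = there (occurrences⇒∈ v S p)

-- A generator of 123-avoiding words

-- A state (m, S, h) of the generator below describes what is left to write after a
-- prefix of a 123-avoiding word: all values below m (the current minimum), the values
-- in S, listed in decreasing order, and the hole if h holds.  The entries of a
-- 123-avoiding word that are not left-to-right minima decrease, so the next letter is
-- the hole, a new minimum x < m (the values between x and m become pending), or the
-- head of S.
remaining : ℕ → List ℕ → Bool → Maybe ℕ → ℕ
remaining m S h nothing  = ind h
remaining m S h (just v) = ind (v <ᵇ m) + occurrences v S

UsesExactly : ∀ {k} → ℕ → List ℕ → Bool → ℕWord k → Set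
UsesExactly m S h u = ∀ x → multiplicity x u ≡ remaining m S h x

skipped : ℕ → ℕ → List ℕ
skipped x zero    = []
skipped x (suc d) = suc x + d ∷ skipped x d

length-skipped : ∀ x d → length (skipped x d) ≡ d
length-skipped x zero    = refl
length-skipped x (suc d) = cong suc (length-skipped x d)

afterMin : ℕ → ℕ → List ℕ → List ℕ
afterMin x m S = S ++ skipped x (m ∸ suc x)

length-afterMin : ∀ x m S → length (afterMin x m S) ≡ length S + (m ∸ suc x)
length-afterMin x m S = trans (length-++ S) (cong (length S +_) (length-skipped x (m ∸ suc x)))

remaining-hole : ∀ m S x → sameLetter x nothing + remaining m S false x ≡ remaining m S true x
remaining-hole m S nothing  = refl
remaining-hole m S (just v) = refl

ind-<ᵇ-skipped : ∀ x d v → ind (v <ᵇ suc (x + d)) ≡ ind (v <ᵇ suc x) + occurrences v (skipped x d)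
ind-<ᵇ-skipped x zero    v = trans (cong (λ c → ind (v <ᵇ suc c)) (+-identityʳ x)) (sym (+-identityʳ _))
ind-<ᵇ-skipped x (suc d) v = begin
  ind (v <ᵇ suc (x + suc d))
    ≡⟨ cong (λ c → ind (v <ᵇ suc c)) (+-suc x d) ⟩
  ind (v <ᵇ suc (suc (x + d)))
    ≡⟨ ind-<ᵇ-suc v (suc (x + d)) ⟩
  ind (v <ᵇ suc (x + d)) + ind (v ≡ᵇ suc (x + d))
    ≡⟨ cong (_+ ind (v ≡ᵇ suc (x + d))) (ind-<ᵇ-skipped x d v) ⟩
  ind (v <ᵇ suc x) + occurrences v (skipped x d) + ind (v ≡ᵇ suc (x + d))
    ≡⟨ xy∙z≈x∙zy (ind (v <ᵇ suc x)) (occurrences v (skipped x d)) (ind (v ≡ᵇ suc (x + d))) ⟩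
  ind (v <ᵇ suc x) + occurrences v (skipped x (suc d)) ∎

remaining-min : ∀ m S h x → x < m →
  ∀ y → sameLetter y (just x) + remaining x (afterMin x m S) h y ≡ remaining m S h y
remaining-min m S h x x<m nothing  = refl
remaining-min m S h x x<m (just v) = begin
  ind (v ≡ᵇ x) + (ind (v <ᵇ x) + occurrences v (S ++ skipped x d))
    ≡⟨ cong (λ c → ind (v ≡ᵇ x) + (ind (v <ᵇ x) + c)) (occurrences-++ v S (skipped x d)) ⟩
  ind (v ≡ᵇ x) + (ind (v <ᵇ x) + (occurrences v S + occurrences v (skipped x d)))
    ≡⟨ regroup (ind (v ≡ᵇ x)) (ind (v <ᵇ x)) (occurrences v S) _ ⟩
  (ind (v <ᵇ x) + ind (v ≡ᵇ x) + occurrences v (skipped x d)) + occurrences v S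
    ≡⟨ cong (λ c → c + occurrences v (skipped x d) + occurrences v S) (ind-<ᵇ-suc v x) ⟨
  (ind (v <ᵇ suc x) + occurrences v (skipped x d)) + occurrences v S
    ≡⟨ cong (_+ occurrences v S) (ind-<ᵇ-skipped x d v) ⟨
  ind (v <ᵇ suc (x + d)) + occurrences v S
    ≡⟨ cong (λ c → ind (v <ᵇ c) + occurrences v S) (m+[n∸m]≡n x<m) ⟩
  ind (v <ᵇ m) + occurrences v S ∎
  where
  d = m ∸ suc x
  regroup : ∀ a b c e → a + (b + (c + e)) ≡ (b + a + e) + c
  regroup = solve-∀

remaining-pending : ∀ m s S h y → sameLetter y (just s) + remaining m S h y ≡ remaining m (s ∷ S) h y
remaining-pending m s S h nothing  = refl
remaining-pending m s S h (just v) = x∙yz≈y∙xz (ind (v ≡ᵇ s)) (ind (v <ᵇ m)) (occurrences v S)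

concatBelow : ∀ {A : Set} → ℕ → (ℕ → List A) → List A
concatBelow zero    g = []
concatBelow (suc a) g = concatBelow a g ++ g a

∈-concatBelow⁻ : ∀ {A : Set} a (g : ℕ → List A) {v} → v ∈ concatBelow a g → ∃ λ x → x < a × v ∈ g x
∈-concatBelow⁻ (suc a) g v∈ with ∈-++⁻ (concatBelow a g) v∈
... | inj₁ v∈′ = let x , x<a , v∈gx = ∈-concatBelow⁻ a g v∈′ in x , m<n⇒m<1+n x<a , v∈gx
... | inj₂ v∈ga = a , ≤-refl , v∈ga

∈-concatBelow⁺ : ∀ {A : Set} a (g : ℕ → List A) {v} x → x < a → v ∈ g x → v ∈ concatBelow a g
∈-concatBelow⁺ (suc a) g x x<1+a v∈gx with m≤n⇒m<n∨m≡n (≤-pred x<1+a)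
... | inj₁ x<a  = ∈-++⁺ˡ (∈-concatBelow⁺ a g x x<a v∈gx)
... | inj₂ refl = ∈-++⁺ʳ (concatBelow a g) v∈gx

concatBelow-unique : ∀ {A : Set} a (g : ℕ → List A) → (∀ x → x < a → Unique (g x)) →
                     (∀ x y {v} → v ∈ g x → v ∈ g y → x ≡ y) → Unique (concatBelow a g)
concatBelow-unique zero    g unique disjoint = []
concatBelow-unique (suc a) g unique disjoint =
  Unique.++⁺ (concatBelow-unique a g (λ x x<a → unique x (m<n⇒m<1+n x<a)) disjoint) (unique a ≤-refl)
    λ (v∈ , v∈ga) → let x , x<a , v∈gx = ∈-concatBelow⁻ a g v∈ in <-irrefl (disjoint x a v∈gx v∈ga) x<a

mutual
  avoiders : (k : ℕ) → ℕ → List ℕ → Bool → List (ℕWord k)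
  avoiders zero    m S h = [ [] ]
  avoiders (suc k) m S h = holeFirst k m S h ++ minFirst k m S h ++ pendingFirst k m S h

  holeFirst : ∀ k → ℕ → List ℕ → Bool → List (ℕWord (suc k))
  holeFirst k m S h = if h then map (nothing ∷_) (avoiders k m S false) else []

  minFirst : ∀ k → ℕ → List ℕ → Bool → List (ℕWord (suc k))
  minFirst k m S h = concatBelow m (λ x → map (just x ∷_) (avoiders k x (afterMin x m S) h))

  pendingFirst : ∀ k → ℕ → List ℕ → Bool → List (ℕWord (suc k))
  pendingFirst k m []      h = []
  pendingFirst k m (s ∷ S) h = map (just s ∷_) (avoiders k m S h)

-- Counting the generated words

sumBelow : ℕ → (ℕ → ℕ) → ℕ
sumBelow zero    f = 0
sumBelow (suc a) f = sumBelow a f + f a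

sumBelow-cong : ∀ a {f g} → (∀ x → x < a → f x ≡ g x) → sumBelow a f ≡ sumBelow a g
sumBelow-cong zero    eq = refl
sumBelow-cong (suc a) eq = cong₂ _+_ (sumBelow-cong a (λ x x<a → eq x (m<n⇒m<1+n x<a))) (eq a ≤-refl)

sumBelow-*ˡ : ∀ c a f → sumBelow a (λ x → c * f x) ≡ c * sumBelow a f
sumBelow-*ˡ c zero    f = sym (*-zeroʳ c)
sumBelow-*ˡ c (suc a) f = begin
  sumBelow a (λ x → c * f x) + c * f a ≡⟨ cong (_+ c * f a) (sumBelow-*ˡ c a f) ⟩
  c * sumBelow a f + c * f a           ≡⟨ *-distribˡ-+ c (sumBelow a f) (f a) ⟨
  c * (sumBelow a f + f a)             ∎

onPred : ℕ → (ℕ → ℕ) → ℕ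
onPred zero    g = 0
onPred (suc b) g = g b

#avoiders : ℕ → ℕ → ℕ → Bool → ℕ
#avoiders zero    a b h = 1
#avoiders (suc k) a b h =
  (if h then #avoiders k a b false else 0)
  + sumBelow a (λ x → #avoiders k x (b + (a ∸ suc x)) h)
  + onPred b (λ b′ → #avoiders k a b′ h)

#avoiders-peel : ∀ k a b →
  #avoiders (suc k) (suc a) b false ≡
  #avoiders (suc k) a (suc b) false + onPred b (λ b′ → #avoiders k (suc a) b′ false)
#avoiders-peel k a b = cong (_+ onPred b (λ b′ → #avoiders k (suc a) b′ false)) (cong₂ _+_
  (sumBelow-cong a (λ x x<a → cong (λ c → #avoiders k x c false)
    (trans (cong (b +_) (+-∸-assoc 1 x<a)) (+-suc b (a ∸ suc x)))))
  (cong (λ c → #avoiders k a c false) (trans (cong (b +_) (n∸n≡0 a)) (+-identityʳ b))))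

pascal-combine : ∀ n a x h₁ h₂ →
  h₁ + n C suc x ≡ n C a → h₂ + n C x ≡ n C suc a →
  h₁ + h₂ + suc n C suc x ≡ suc n C suc a
pascal-combine n a x h₁ h₂ eq₁ eq₂ = begin
  h₁ + h₂ + suc n C suc x               ≡⟨ cong (h₁ + h₂ +_) (nCk+nC[k+1]≡[n+1]C[k+1] n x) ⟨
  h₁ + h₂ + (n C x + n C suc x)         ≡⟨ regroup h₁ h₂ (n C x) (n C suc x) ⟩
  (h₁ + n C suc x) + (h₂ + n C x)       ≡⟨ cong₂ _+_ eq₁ eq₂ ⟩
  n C a + n C suc a                     ≡⟨ nCk+nC[k+1]≡[n+1]C[k+1] n a ⟩
  suc n C suc a                         ∎
  where
  regroup : ∀ p q r s → p + q + (r + s) ≡ (p + s) + (q + r)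
  regroup = solve-∀

-- #avoiders k a b false is the ballot number C(2a+b, a) - C(2a+b, a+b+1), stated additively
-- to avoid truncated subtraction.
#avoiders-ballot : ∀ k a b → a + b ≡ k →
  #avoiders k a b false + (a + a + b) C suc k ≡ (a + a + b) C a
#avoiders-ballot zero    zero    zero    _ = refl
#avoiders-ballot (suc k) zero    (suc k) refl = begin
  #avoiders k 0 k false + suc k C suc (suc k) ≡⟨ cong (#avoiders k 0 k false +_) (k>n⇒nCk≡0 (n<1+n (suc k))) ⟩
  #avoiders k 0 k false + 0                   ≡⟨ cong (#avoiders k 0 k false +_) (k>n⇒nCk≡0 (n<1+n k)) ⟨
  #avoiders k 0 k false + k C suc k           ≡⟨ #avoiders-ballot k 0 k refl ⟩
  1                                           ∎
#avoiders-ballot (suc k) (suc a) b e = begin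
  #avoiders (suc k) (suc a) b false + (suc a + suc a + b) C suc (suc k)
    ≡⟨ cong₂ _+_ (#avoiders-peel k a b) (cong (_C suc (suc k)) n≡) ⟩
  #avoiders (suc k) a (suc b) false + onPred b (λ b′ → #avoiders k (suc a) b′ false) + suc n C suc (suc k)
    ≡⟨ pascal-combine n a (suc k) _ _ (#avoiders-ballot (suc k) a (suc b) (trans (+-suc a b) e)) (tail b e) ⟩
  suc n C suc a
    ≡⟨ cong (_C suc a) n≡ ⟨
  (suc a + suc a + b) C suc a ∎
  where
  n = a + a + suc b
  n≡ : suc a + suc a + b ≡ suc n
  n≡ = lemma a b
    where
    lemma : ∀ a b → suc a + suc a + b ≡ suc (a + a + suc b)
    lemma = solve-∀
  tail : ∀ b → suc a + b ≡ suc k →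
         onPred b (λ b′ → #avoiders k (suc a) b′ false) + (a + a + suc b) C suc k ≡ (a + a + suc b) C suc a
  tail zero    e = cong (λ c → (a + a + 1) C suc c) (sym (trans (sym (+-identityʳ a)) (suc-injective e)))
  tail (suc b) e = subst (λ m → #avoiders k (suc a) b false + m C suc k ≡ m C suc a)
    (lemma a b) (#avoiders-ballot k (suc a) b (suc-injective (trans (sym (+-suc (suc a) b)) e)))
    where
    lemma : ∀ a b → suc a + suc a + b ≡ a + a + suc (suc b)
    lemma = solve-∀

-- Each of the k + 1 positions can hold the hole.
#avoiders-hole : ∀ k a b → a + b ≡ k → #avoiders (suc k) a b true ≡ suc k * #avoiders k a b false
#avoiders-hole zero    zero    zero    _ = refl
#avoiders-hole (suc k) a       b       e = begin
  H + sumBelow a (child (suc k) true) + onPred b (pending (suc k) true)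
    ≡⟨ cong₂ (λ s p → H + s + p) children (pendings e) ⟩
  H + suc k * sumBelow a (child k false) + suc k * onPred b (pending k false)
    ≡⟨ +-assoc H _ _ ⟩
  H + (suc k * sumBelow a (child k false) + suc k * onPred b (pending k false))
    ≡⟨ cong (H +_) (*-distribˡ-+ (suc k) (sumBelow a (child k false)) (onPred b (pending k false))) ⟨
  suc (suc k) * H ∎
  where
  H = #avoiders (suc k) a b false
  child : ℕ → Bool → ℕ → ℕ
  child l h x = #avoiders l x (b + (a ∸ suc x)) h
  pending : ℕ → Bool → ℕ → ℕ
  pending l h b′ = #avoiders l a b′ h
  childSize : ∀ x → x < a → x + (b + (a ∸ suc x)) ≡ k
  childSize x x<a = suc-injective (begin
    suc x + (b + (a ∸ suc x)) ≡⟨ lemma x b (a ∸ suc x) ⟩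
    (a ∸ suc x + suc x) + b   ≡⟨ cong (_+ b) (m∸n+n≡m x<a) ⟩
    a + b                     ≡⟨ e ⟩
    suc k                     ∎)
    where
    lemma : ∀ x b d → suc x + (b + d) ≡ (d + suc x) + b
    lemma = solve-∀
  children : sumBelow a (child (suc k) true) ≡ suc k * sumBelow a (child k false)
  children = trans (sumBelow-cong a (λ x x<a → #avoiders-hole k x _ (childSize x x<a)))
                   (sumBelow-*ˡ (suc k) a (child k false))
  pendings : ∀ {b} → a + b ≡ suc k → onPred b (pending (suc k) true) ≡ suc k * onPred b (pending k false)
  pendings {zero}   _  = sym (*-zeroʳ (suc k))
  pendings {suc b′} e′ = #avoiders-hole k a b′ (suc-injective (trans (sym (+-suc a b′)) e′))

[1+k]*[1+n]C[1+k]≡[1+n]*nCk : ∀ n k → suc k * (suc n C suc k) ≡ suc n * (n C k)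
[1+k]*[1+n]C[1+k]≡[1+n]*nCk zero    zero    = refl
[1+k]*[1+n]C[1+k]≡[1+n]*nCk zero    (suc k) = begin
  suc (suc k) * (1 C suc (suc k)) ≡⟨ cong (suc (suc k) *_) (k>n⇒nCk≡0 {1} (s≤s (s≤s (z≤n {k})))) ⟩
  suc (suc k) * 0                 ≡⟨ *-zeroʳ (suc (suc k)) ⟩
  0                               ∎
[1+k]*[1+n]C[1+k]≡[1+n]*nCk (suc n) zero    =
  trans (+-identityʳ _) (trans (nC1≡n (suc (suc n))) (sym (*-identityʳ _)))
[1+k]*[1+n]C[1+k]≡[1+n]*nCk (suc n) (suc k) = begin
  suc (suc k) * (suc (suc n) C suc (suc k))   ≡⟨ cong (suc (suc k) *_) (nCk+nC[k+1]≡[n+1]C[k+1] (suc n) (suc k)) ⟨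
  suc (suc k) * (A + B)                       ≡⟨ *-distribˡ-+ (suc (suc k)) A B ⟩
  A + suc k * A + suc (suc k) * B             ≡⟨ cong₂ (λ u v → A + u + v) ([1+k]*[1+n]C[1+k]≡[1+n]*nCk n k)
                                                                          ([1+k]*[1+n]C[1+k]≡[1+n]*nCk n (suc k)) ⟩
  A + suc n * (n C k) + suc n * (n C suc k)   ≡⟨ +-assoc A _ _ ⟩
  A + (suc n * (n C k) + suc n * (n C suc k)) ≡⟨ cong (A +_) (*-distribˡ-+ (suc n) (n C k) (n C suc k)) ⟨
  A + suc n * (n C k + n C suc k)             ≡⟨ cong (λ u → A + suc n * u) (nCk+nC[k+1]≡[n+1]C[k+1] n k) ⟩
  A + suc n * A                               ∎
  where
  A = suc n C suc k
  B = suc n C suc (suc k)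

[1+N]*#avoiders≡[2N]CN : ∀ N → suc N * #avoiders N N 0 false ≡ (N + N) C N
[1+N]*#avoiders≡[2N]CN N = +-cancelʳ-≡ (N * c) (suc N * h) c (begin
  suc N * h + N * c       ≡⟨ cong (suc N * h +_) [1+N]*c′≡N*c ⟨
  suc N * h + suc N * c′  ≡⟨ *-distribˡ-+ (suc N) h c′ ⟨
  suc N * (h + c′)        ≡⟨ cong (suc N *_) ballot ⟩
  suc N * c               ∎)
  where
  h = #avoiders N N 0 false
  c = (N + N) C N
  c′ = (N + N) C suc N
  ballot : h + c′ ≡ c
  ballot = subst (λ m → h + m C suc N ≡ m C N) (+-identityʳ (N + N)) (#avoiders-ballot N N 0 (+-identityʳ N))
  [1+N]*c′≡N*c : suc N * c′ ≡ N * c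
  [1+N]*c′≡N*c = +-cancelˡ-≡ (suc N * c) (suc N * c′) (N * c) (begin
    suc N * c + suc N * c′     ≡⟨ *-distribˡ-+ (suc N) c c′ ⟨
    suc N * (c + c′)           ≡⟨ cong (suc N *_) (nCk+nC[k+1]≡[n+1]C[k+1] (N + N) N) ⟩
    suc N * (suc (N + N) C suc N) ≡⟨ [1+k]*[1+n]C[1+k]≡[1+n]*nCk (N + N) N ⟩
    suc (N + N) * c            ≡⟨ lemma N c ⟩
    suc N * c + N * c          ∎)
    where
    lemma : ∀ N c → suc (N + N) * c ≡ suc N * c + N * c
    lemma = solve-∀

length-concatBelow : ∀ {A : Set} a (g : ℕ → List A) → length (concatBelow a g) ≡ sumBelow a (length ∘ g)
length-concatBelow zero    g = refl
length-concatBelow (suc a) g = trans (length-++ (concatBelow a g)) (cong (_+ length (g a)) (length-concatBelow a g))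

length-avoiders : ∀ k m S h → length (avoiders k m S h) ≡ #avoiders k m (length S) h
length-avoiders zero    m S h = refl
length-avoiders (suc k) m S h = begin
  length (holeFirst k m S h ++ minFirst k m S h ++ pendingFirst k m S h)
    ≡⟨ length-++ (holeFirst k m S h) ⟩
  length (holeFirst k m S h) + length (minFirst k m S h ++ pendingFirst k m S h)
    ≡⟨ cong (length (holeFirst k m S h) +_) (length-++ (minFirst k m S h)) ⟩
  length (holeFirst k m S h) + (length (minFirst k m S h) + length (pendingFirst k m S h))
    ≡⟨ +-assoc (length (holeFirst k m S h)) _ _ ⟨
  length (holeFirst k m S h) + length (minFirst k m S h) + length (pendingFirst k m S h)
    ≡⟨ cong₂ _+_ (cong₂ _+_ (length-holeFirst h) length-minFirst) (length-pendingFirst S) ⟩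
  #avoiders (suc k) m (length S) h ∎
  where
  length-holeFirst : ∀ h → length (holeFirst k m S h) ≡ (if h then #avoiders k m (length S) false else 0)
  length-holeFirst true  = trans (length-map _ (avoiders k m S false)) (length-avoiders k m S false)
  length-holeFirst false = refl
  length-minFirst : length (minFirst k m S h) ≡ sumBelow m (λ x → #avoiders k x (length S + (m ∸ suc x)) h)
  length-minFirst = trans (length-concatBelow m _) (sumBelow-cong m λ x _ → begin
    length (map (just x ∷_) (avoiders k x (afterMin x m S) h))
      ≡⟨ length-map _ (avoiders k x (afterMin x m S) h) ⟩
    length (avoiders k x (afterMin x m S) h)
      ≡⟨ length-avoiders k x (afterMin x m S) h ⟩
    #avoiders k x (length (afterMin x m S)) h
      ≡⟨ cong (λ b → #avoiders k x b h) (length-afterMin x m S) ⟩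
    #avoiders k x (length S + (m ∸ suc x)) h ∎)
  length-pendingFirst : ∀ S → length (pendingFirst k m S h) ≡ onPred (length S) (λ b → #avoiders k m b h)
  length-pendingFirst []      = refl
  length-pendingFirst (s ∷ S) = trans (length-map _ (avoiders k m S h)) (length-avoiders k m S h)

-- The generator produces exactly the admissible words

-- m is the current minimum (initially a strict upper bound) and M the last entry
-- that was not a new minimum (initially a strict upper bound).
Admissible : ∀ {k} → ℕ → ℕ → ℕWord k → Set
Admissible m M []            = ⊤
Admissible m M (nothing ∷ u) = Admissible m M u
Admissible m M (just x ∷ u)  = (x < m × Admissible x M u) ⊎ (m < x × x < M × Admissible m x u)

multiplicity-tail : ∀ {k z x} {u : ℕWord k} →
                    0 < multiplicity (just z) (just x ∷ u) → z ≢ x → 0 < multiplicity (just z) u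
multiplicity-tail p z≢x = subst (λ c → 0 < c + _) (ind-≡ᵇ-≢ z≢x) p

admissible-bound : ∀ {k} m M (u : ℕWord k) → Admissible m M u → m ≤ M → ∀ z → 0 < multiplicity (just z) u → z < M
admissible-bound m M (nothing ∷ u) adm m≤M z p = admissible-bound m M u adm m≤M z p
admissible-bound m M (just x ∷ u) (inj₁ (x<m , adm)) m≤M z p with z ≟ x
... | yes refl = <-≤-trans x<m m≤M
... | no  z≢x  = admissible-bound x M u adm (<⇒≤ (<-≤-trans x<m m≤M)) z (multiplicity-tail {u = u} p z≢x)
admissible-bound m M (just x ∷ u) (inj₂ (m<x , x<M , adm)) m≤M z p with z ≟ x
... | yes refl = x<M
... | no  z≢x  = <-trans (admissible-bound m x u adm (<⇒≤ m<x) z (multiplicity-tail {u = u} p z≢x)) x<M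

record Pending (m M : ℕ) (S : List ℕ) : Set where
  field
    descending : AllPairs _>_ S
    above      : All (m <_) S
    below      : All (_< M) S
    m<M        : m < M
open Pending

skipped-between : ∀ x d → All (λ y → x < y × y < suc (x + d)) (skipped x d)
skipped-between x zero    = []
skipped-between x (suc d) = (s≤s (m≤m+n x d) , x+d<x+1+d)
  ∷ All.map (λ (x<y , y<) → x<y , <-trans y< x+d<x+1+d) (skipped-between x d)
  where
  x+d<x+1+d : suc (x + d) < suc (x + suc d)
  x+d<x+1+d = s≤s (≤-reflexive (sym (+-suc x d)))

skipped-descending : ∀ x d → AllPairs _>_ (skipped x d)
skipped-descending x zero    = []
skipped-descending x (suc d) = All.map proj₂ (skipped-between x d) ∷ skipped-descending x d

above-afterMin : ∀ {x m S} → x < m → All (m <_) S → All (x <_) (afterMin x m S)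
above-afterMin {x} {m} x<m m<S = All.++⁺ (All.map (<-trans x<m) m<S) (All.map proj₁ (skipped-between x (m ∸ suc x)))

pending-afterMin : ∀ {x m M S} → x < m → Pending m M S → Pending x M (afterMin x m S)
pending-afterMin {x} {m} {M} {S} x<m pend = record
  { descending = AllPairs.++⁺ (descending pend) (skipped-descending x d)
      (All.map (λ m<s → All.map (λ (_ , y<m) → <-trans y<m m<s) gap) (above pend))
  ; above      = above-afterMin x<m (above pend)
  ; below      = All.++⁺ (below pend) (All.map (λ (_ , y<m) → <-trans y<m (m<M pend)) gap)
  ; m<M        = <-trans x<m (m<M pend)
  }
  where
  d = m ∸ suc x
  gap : All (λ y → x < y × y < m) (skipped x d)
  gap = All.map (λ (x<y , y<) → x<y , subst (_ <_) (m+[n∸m]≡n x<m) y<) (skipped-between x d)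

pending-tail : ∀ {m M s S} → Pending m M (s ∷ S) → Pending m s S
pending-tail record { descending = s>S ∷ desc ; above = m<s ∷ m<S ; below = _ ; m<M = _ } =
  record { descending = desc ; above = m<S ; below = s>S ; m<M = m<s }

toWrite : ℕ → List ℕ → Bool → ℕ
toWrite m S h = m + length S + ind h

toWrite-hole : ∀ m S → toWrite m S true ≡ suc (toWrite m S false)
toWrite-hole m S = lemma m (length S)
  where
  lemma : ∀ a b → a + b + 1 ≡ suc (a + b + 0)
  lemma = solve-∀

toWrite-afterMin : ∀ {x m} S h → x < m → toWrite m S h ≡ suc (toWrite x (afterMin x m S) h)
toWrite-afterMin {x} {m} S h x<m = begin
  m + length S + ind h                               ≡⟨ cong (λ c → c + length S + ind h) (m+[n∸m]≡n x<m) ⟨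
  suc x + (m ∸ suc x) + length S + ind h             ≡⟨ lemma x (m ∸ suc x) (length S) (ind h) ⟩
  suc (x + (length S + (m ∸ suc x)) + ind h)         ≡⟨ cong (λ c → suc (x + c + ind h)) (length-afterMin x m S) ⟨
  suc (toWrite x (afterMin x m S) h)                 ∎
  where
  lemma : ∀ x d b c → suc x + d + b + c ≡ suc (x + (b + d) + c)
  lemma = solve-∀

toWrite-pending : ∀ m s S h → toWrite m (s ∷ S) h ≡ suc (toWrite m S h)
toWrite-pending m s S h = lemma m (length S) (ind h)
  where
  lemma : ∀ a b c → a + suc b + c ≡ suc (a + b + c)
  lemma = solve-∀

toWrite≡0⇒empty : ∀ m S h → toWrite m S h ≡ 0 → ∀ x → remaining m S h x ≡ 0
toWrite≡0⇒empty zero []      false _ nothing  = refl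
toWrite≡0⇒empty zero []      false _ (just v) = refl

UsesExactly-∷⁺ : ∀ {k m S h m′ S′ h′ y} {u : ℕWord k} →
  (∀ x → sameLetter x y + remaining m′ S′ h′ x ≡ remaining m S h x) →
  UsesExactly m′ S′ h′ u → UsesExactly m S h (y ∷ u)
UsesExactly-∷⁺ {y = y} step uses x = trans (cong (sameLetter x y +_) (uses x)) (step x)

UsesExactly-∷⁻ : ∀ {k m S h m′ S′ h′ y} {u : ℕWord k} →
  (∀ x → sameLetter x y + remaining m′ S′ h′ x ≡ remaining m S h x) →
  UsesExactly m S h (y ∷ u) → UsesExactly m′ S′ h′ u
UsesExactly-∷⁻ {y = y} step uses x = +-cancelˡ-≡ (sameLetter x y) _ _ (trans (uses x) (sym (step x)))

avoiders-sound : ∀ k m M S h → Pending m M S → toWrite m S h ≡ k →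
                 ∀ u → u ∈ avoiders k m S h → UsesExactly m S h u × Admissible m M u
avoiders-sound zero m M S h pend e .[] (here refl) = (λ x → sym (toWrite≡0⇒empty m S h e x)) , tt
avoiders-sound (suc k) m M S h pend e u u∈
  with ∈-++⁻ (holeFirst k m S h) u∈
avoiders-sound (suc k) m M S true pend e u u∈ | inj₁ u∈holes
  with ∈-map⁻ (nothing ∷_) u∈holes
... | u′ , u′∈ , refl =
  let uses , adm = avoiders-sound k m M S false pend (suc-injective (trans (sym (toWrite-hole m S)) e)) u′ u′∈
  in UsesExactly-∷⁺ {u = u′} (remaining-hole m S) uses , adm
avoiders-sound (suc k) m M S h pend e u u∈ | inj₂ u∈rest
  with ∈-++⁻ (minFirst k m S h) u∈rest
... | inj₁ u∈mins with ∈-concatBelow⁻ m _ u∈mins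
...   | x , x<m , u∈x with ∈-map⁻ (just x ∷_) u∈x
...     | u′ , u′∈ , refl =
  let uses , adm = avoiders-sound k x M (afterMin x m S) h (pending-afterMin x<m pend)
                     (suc-injective (trans (sym (toWrite-afterMin S h x<m)) e)) u′ u′∈
  in UsesExactly-∷⁺ {u = u′} (remaining-min m S h x x<m) uses , inj₁ (x<m , adm)
avoiders-sound (suc k) m M (s ∷ S) h pend e u u∈ | inj₂ u∈rest | inj₂ u∈pending
  with ∈-map⁻ (just s ∷_) u∈pending
... | u′ , u′∈ , refl =
  let uses , adm = avoiders-sound k m s S h (pending-tail pend)
                     (suc-injective (trans (sym (toWrite-pending m s S h)) e)) u′ u′∈
  in UsesExactly-∷⁺ {u = u′} (remaining-pending m s S h) uses ,
     inj₂ (All.head (above pend) , All.head (below pend) , adm)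

nonMin-isPendingHead : ∀ {k m M S h v} {u : ℕWord k} → Pending m M S → UsesExactly m S h (just v ∷ u) →
                       m < v → Admissible m v u → ∃ λ S′ → S ≡ v ∷ S′
nonMin-isPendingHead {m = m} {S = []} {v = v} {u} pend uses m<v adm = ⊥-elim (1+n≢0 (begin
  suc (multiplicity (just v) u)             ≡⟨ multiplicity-∷-self (just v) u ⟨
  multiplicity (just v) (just v ∷ u)        ≡⟨ uses (just v) ⟩
  ind (v <ᵇ m) + 0                          ≡⟨ cong (_+ 0) (ind-≮ᵇ (<⇒≤ m<v)) ⟩
  0                                         ∎))
nonMin-isPendingHead {m = m} {S = s ∷ S} {v = v} {u} pend uses m<v adm with v ≟ s
... | yes refl = S , refl
... | no  v≢s  = ⊥-elim (<-asym v<s s<v)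
  where
  v∈S : 0 < occurrences v S
  v∈S = subst (0 <_) (begin
    suc (multiplicity (just v) u)                       ≡⟨ multiplicity-∷-self (just v) u ⟨
    multiplicity (just v) (just v ∷ u)                  ≡⟨ uses (just v) ⟩
    ind (v <ᵇ m) + (ind (v ≡ᵇ s) + occurrences v S)
      ≡⟨ cong₂ (λ a b → a + (b + occurrences v S)) (ind-≮ᵇ (<⇒≤ m<v)) (ind-≡ᵇ-≢ v≢s) ⟩
    occurrences v S                                     ∎) (s≤s z≤n)
  v<s : v < s
  v<s with descending pend
  ... | s>S ∷ _ = All.lookup s>S (occurrences⇒∈ v S v∈S)
  s∈u : 0 < multiplicity (just s) u
  s∈u = subst (0 <_) (begin
    ind (s <ᵇ m) + (1 + occurrences s S)
      ≡⟨ cong (λ c → ind (s <ᵇ m) + (c + occurrences s S)) (ind-≡ᵇ-refl s) ⟨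
    ind (s <ᵇ m) + (ind (s ≡ᵇ s) + occurrences s S)         ≡⟨ uses (just s) ⟨
    ind (s ≡ᵇ v) + multiplicity (just s) u
      ≡⟨ cong (_+ multiplicity (just s) u) (ind-≡ᵇ-≢ (v≢s ∘ sym)) ⟩
    multiplicity (just s) u                                 ∎) (<-≤-trans (s≤s z≤n) (m≤n+m _ (ind (s <ᵇ m))))
  s<v : s < v
  s<v = admissible-bound m v u adm (<⇒≤ m<v) s s∈u

avoiders-complete : ∀ k m M S h → Pending m M S → toWrite m S h ≡ k →
                    ∀ u → UsesExactly m S h u → Admissible m M u → u ∈ avoiders k m S h
avoiders-complete zero m M S h pend e [] uses adm = here refl
avoiders-complete (suc k) m M S true pend e (nothing ∷ u) uses adm =
  ∈-++⁺ˡ (∈-map⁺ (nothing ∷_)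
    (avoiders-complete k m M S false pend (suc-injective (trans (sym (toWrite-hole m S)) e)) u
      (UsesExactly-∷⁻ {u = u} (remaining-hole m S) uses) adm))
avoiders-complete (suc k) m M S false pend e (nothing ∷ u) uses adm with uses nothing
... | ()
avoiders-complete (suc k) m M S h pend e (just v ∷ u) uses (inj₁ (v<m , adm)) =
  ∈-++⁺ʳ (holeFirst k m S h)
    (∈-++⁺ˡ (∈-concatBelow⁺ m _ v v<m (∈-map⁺ (just v ∷_)
      (avoiders-complete k v M (afterMin v m S) h (pending-afterMin v<m pend)
        (suc-injective (trans (sym (toWrite-afterMin S h v<m)) e)) u
        (UsesExactly-∷⁻ {u = u} (remaining-min m S h v v<m) uses) adm))))
avoiders-complete (suc k) m M S h pend e (just v ∷ u) uses (inj₂ (m<v , v<M , adm))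
  with nonMin-isPendingHead {u = u} pend uses m<v adm
... | S′ , refl =
  ∈-++⁺ʳ (holeFirst k m S h) (∈-++⁺ʳ (minFirst k m S h)
      (∈-map⁺ (just v ∷_)
        (avoiders-complete k m v S′ h (pending-tail pend) (suc-injective (trans (sym (toWrite-pending m v S′ h)) e)) u
          (UsesExactly-∷⁻ {u = u} (remaining-pending m v S′ h) uses) adm)))

head-∈-map : ∀ {k} y (l : List (ℕWord k)) {v} → v ∈ map (y ∷_) l → head v ≡ y
head-∈-map y l v∈ with ∈-map⁻ (y ∷_) v∈
... | _ , _ , refl = refl

avoiders-unique : ∀ k m S h → All (m <_) S → Unique (avoiders k m S h)
avoiders-unique zero    m S h m<S = [] ∷ []
avoiders-unique (suc k) m S h m<S =
  Unique.++⁺ (holeFirst-unique h) (Unique.++⁺ minFirst-unique (pendingFirst-unique S m<S) minFirst∩pendingFirst)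
    holeFirst∩rest
  where
  consUnique : ∀ y {l : List (ℕWord k)} → Unique l → Unique (map (y ∷_) l)
  consUnique y = Unique.map⁺ ∷-injectiveʳ
  holeFirst-unique : ∀ h → Unique (holeFirst k m S h)
  holeFirst-unique true  = consUnique nothing (avoiders-unique k m S false m<S)
  holeFirst-unique false = []
  minFirst-unique : Unique (minFirst k m S h)
  minFirst-unique = concatBelow-unique m _
    (λ x x<m → consUnique (just x) (avoiders-unique k x (afterMin x m S) h (above-afterMin x<m m<S)))
    (λ x y v∈x v∈y → Maybe.just-injective (trans (sym (head-∈-map (just x) _ v∈x)) (head-∈-map (just y) _ v∈y)))
  pendingFirst-unique : ∀ S → All (m <_) S → Unique (pendingFirst k m S h)
  pendingFirst-unique []      _         = []
  pendingFirst-unique (s ∷ S) (_ ∷ m<S) = consUnique (just s) (avoiders-unique k m S h m<S)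
  head-holeFirst : ∀ h {v} → v ∈ holeFirst k m S h → head v ≡ nothing
  head-holeFirst true v∈ = head-∈-map nothing _ v∈
  head-minFirst : ∀ {v} → v ∈ minFirst k m S h → ∃ λ x → x < m × head v ≡ just x
  head-minFirst v∈ = let x , x<m , v∈x = ∈-concatBelow⁻ m _ v∈ in x , x<m , head-∈-map (just x) _ v∈x
  head-pendingFirst : ∀ S → All (m <_) S → ∀ {v} → v ∈ pendingFirst k m S h → ∃ λ s → m < s × head v ≡ just s
  head-pendingFirst (s ∷ S) (m<s ∷ _) v∈ = s , m<s , head-∈-map (just s) _ v∈
  minFirst∩pendingFirst : ∀ {v} → ¬ (v ∈ minFirst k m S h × v ∈ pendingFirst k m S h)
  minFirst∩pendingFirst (v∈mins , v∈pendings) with head-minFirst v∈mins | head-pendingFirst S m<S v∈pendings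
  ... | x , x<m , eqx | s , m<s , eqs with trans (sym eqx) eqs
  ...   | refl = <-asym x<m m<s
  just≢nothing : ∀ {x : ℕ} → just x ≢ nothing
  just≢nothing ()
  holeFirst∩rest : ∀ {v} → ¬ (v ∈ holeFirst k m S h × v ∈ minFirst k m S h ++ pendingFirst k m S h)
  holeFirst∩rest (v∈holes , v∈rest) with ∈-++⁻ (minFirst k m S h) v∈rest
  ... | inj₁ v∈mins     = let _ , _ , eq = head-minFirst v∈mins
                          in just≢nothing (trans (sym eq) (head-holeFirst h v∈holes))
  ... | inj₂ v∈pendings = let _ , _ , eq = head-pendingFirst S m<S v∈pendings
                          in just≢nothing (trans (sym eq) (head-holeFirst h v∈holes))

-- Admissible words are the 123-avoiding ones

data Has123 {k} (u : ℕWord k) : Set where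
  has123 : ∀ {a b c x y z} → a Fin.< b → b Fin.< c →
           lookup u a ≡ just x → lookup u b ≡ just y → lookup u c ≡ just z → x < y → y < z → Has123 u

data AscentAbove {k} (m : ℕ) (u : ℕWord k) : Set where
  ascent : ∀ {b c y z} → b Fin.< c → lookup u b ≡ just y → lookup u c ≡ just z → m < y → y < z → AscentAbove m u

Distinct : ∀ {k} → ℕWord k → Set
Distinct {k} u = ∀ (i j : Fin k) {z} → lookup u i ≡ just z → lookup u j ≡ just z → i ≡ j

Has123-∷⁻ : ∀ {k y} {u : ℕWord k} → Has123 (y ∷ u) → Has123 u ⊎ ∃ λ x → y ≡ just x × AscentAbove x u
Has123-∷⁻ (has123 {zero}  {suc _} {suc _} _   b<c ea eb ec x<y y<z) =
  inj₂ (_ , ea , ascent (≤-pred b<c) eb ec x<y y<z)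
Has123-∷⁻ (has123 {suc _} {suc _} {suc _} a<b b<c ea eb ec x<y y<z) =
  inj₁ (has123 (≤-pred a<b) (≤-pred b<c) ea eb ec x<y y<z)

Has123-∷⁺ : ∀ {k y} {u : ℕWord k} → Has123 u → Has123 (y ∷ u)
Has123-∷⁺ (has123 a<b b<c ea eb ec x<y y<z) = has123 (s≤s a<b) (s≤s b<c) ea eb ec x<y y<z

AscentAbove-∷⁻ : ∀ {k m y} {u : ℕWord k} → AscentAbove m (y ∷ u) →
                AscentAbove m u ⊎ ∃₂ λ x c → y ≡ just x × m < x × ∃ λ z → lookup u c ≡ just z × x < z
AscentAbove-∷⁻ (ascent {zero}  {suc c} _   ey ez m<y y<z) = inj₂ (_ , c , ey , m<y , _ , ez , y<z)
AscentAbove-∷⁻ (ascent {suc _} {suc _} b<c ey ez m<y y<z) = inj₁ (ascent (≤-pred b<c) ey ez m<y y<z)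

AscentAbove-∷⁺ : ∀ {k m y} {u : ℕWord k} → AscentAbove m u → AscentAbove m (y ∷ u)
AscentAbove-∷⁺ (ascent b<c ey ez m<y y<z) = ascent (s≤s b<c) ey ez m<y y<z

AscentAbove-mono : ∀ {k m m′} {u : ℕWord k} → m′ ≤ m → AscentAbove m u → AscentAbove m′ u
AscentAbove-mono m′≤m (ascent b<c ey ez m<y y<z) = ascent b<c ey ez (≤-<-trans m′≤m m<y) y<z

lookup⇒multiplicity : ∀ {k} (u : ℕWord k) j {z} → lookup u j ≡ just z → 0 < multiplicity (just z) u
lookup⇒multiplicity (y ∷ u) zero    {z} refl = subst (0 <_) (sym (multiplicity-∷-self (just z) u)) (s≤s z≤n)
lookup⇒multiplicity (y ∷ u) (suc j) {z} ez   =
  <-≤-trans (lookup⇒multiplicity u j ez) (m≤n+m _ (sameLetter (just z) y))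

admissible⇒avoids : ∀ {k} m M (u : ℕWord k) → Admissible m M u → m ≤ M → ¬ Has123 u × ¬ AscentAbove m u
admissible⇒avoids m M [] _ _ = (λ { (has123 {()} _ _ _ _ _ _ _) }) , (λ { (ascent {()} _ _ _ _ _) })
admissible⇒avoids m M (nothing ∷ u) adm m≤M with admissible⇒avoids m M u adm m≤M
... | no123 , noAscent = no123′ , noAscent′
  where
  no123′ : ¬ Has123 (nothing ∷ u)
  no123′ p with Has123-∷⁻ p
  ... | inj₁ p′ = no123 p′
  no123′ p | inj₂ (_ , () , _)
  noAscent′ : ¬ AscentAbove m (nothing ∷ u)
  noAscent′ p with AscentAbove-∷⁻ p
  ... | inj₁ p′ = noAscent p′
  noAscent′ p | inj₂ (_ , _ , () , _)
admissible⇒avoids m M (just x ∷ u) (inj₁ (x<m , adm)) m≤M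
  with admissible⇒avoids x M u adm (<⇒≤ (<-≤-trans x<m m≤M))
... | no123 , noAscent = no123′ , noAscent′
  where
  no123′ : ¬ Has123 (just x ∷ u)
  no123′ p with Has123-∷⁻ p
  ... | inj₁ p′ = no123 p′
  ... | inj₂ (_ , refl , p′) = noAscent p′
  noAscent′ : ¬ AscentAbove m (just x ∷ u)
  noAscent′ p with AscentAbove-∷⁻ p
  ... | inj₁ p′ = noAscent (AscentAbove-mono (<⇒≤ x<m) p′)
  ... | inj₂ (_ , _ , refl , m<x , _) = <-asym x<m m<x
admissible⇒avoids m M (just x ∷ u) (inj₂ (m<x , x<M , adm)) m≤M
  with admissible⇒avoids m x u adm (<⇒≤ m<x)
... | no123 , noAscent = no123′ , noAscent′
  where
  below-x : ∀ c {z} → lookup u c ≡ just z → z < x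
  below-x c {z} ez = admissible-bound m x u adm (<⇒≤ m<x) z (lookup⇒multiplicity u c ez)
  no123′ : ¬ Has123 (just x ∷ u)
  no123′ p with Has123-∷⁻ p
  ... | inj₁ p′ = no123 p′
  ... | inj₂ (_ , refl , ascent _ ey _ x<y _) = <-asym x<y (below-x _ ey)
  noAscent′ : ¬ AscentAbove m (just x ∷ u)
  noAscent′ p with AscentAbove-∷⁻ p
  ... | inj₁ p′ = noAscent p′
  ... | inj₂ (_ , c , refl , _ , _ , ez , x<z) = <-asym x<z (below-x c ez)

Distinct-∷⁻ : ∀ {k y} {u : ℕWord k} → Distinct (y ∷ u) → Distinct u
Distinct-∷⁻ distinct i j ei ej = Fin.suc-injective (distinct (suc i) (suc j) ei ej)

Distinct-head-fresh : ∀ {k x} {u : ℕWord k} → Distinct (just x ∷ u) → ∀ j {z} → lookup u j ≡ just z → z ≢ x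
Distinct-head-fresh distinct j ez refl with distinct zero (suc j) refl ez
... | ()

avoids⇒admissible : ∀ {k} m M (u : ℕWord k) → ¬ Has123 u → ¬ AscentAbove m u →
  (∀ j {z} → lookup u j ≡ just z → z < M) → (∀ j {z} → lookup u j ≡ just z → z ≢ m) → Distinct u →
  Admissible m M u
avoids⇒admissible m M [] _ _ _ _ _ = tt
avoids⇒admissible m M (nothing ∷ u) no123 noAscent bounded notM distinct =
  avoids⇒admissible m M u (no123 ∘ Has123-∷⁺) (noAscent ∘ AscentAbove-∷⁺) (bounded ∘ suc) (notM ∘ suc)
    (Distinct-∷⁻ distinct)
avoids⇒admissible m M (just x ∷ u) no123 noAscent bounded notM distinct with <-cmp x m
... | tri≈ _ x≡m _ = ⊥-elim (notM zero refl x≡m)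
... | tri< x<m _ _ = inj₁ (x<m , avoids⇒admissible x M u (no123 ∘ Has123-∷⁺) noAscentFrom-x
                                  (bounded ∘ suc) (Distinct-head-fresh distinct) (Distinct-∷⁻ distinct))
  where
  noAscentFrom-x : ¬ AscentAbove x u
  noAscentFrom-x (ascent b<c ey ez x<y y<z) = no123 (has123 (s≤s z≤n) (s≤s b<c) refl ey ez x<y y<z)
... | tri> _ _ m<x = inj₂ (m<x , bounded zero refl ,
                           avoids⇒admissible m x u (no123 ∘ Has123-∷⁺) (noAscent ∘ AscentAbove-∷⁺)
                             below-x (notM ∘ suc) (Distinct-∷⁻ distinct))
  where
  below-x : ∀ j {z} → lookup u j ≡ just z → z < x
  below-x j {z} ez with <-cmp z x
  ... | tri< z<x _ _ = z<x
  ... | tri≈ _ z≡x _ = ⊥-elim (Distinct-head-fresh distinct j ez z≡x)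
  ... | tri> _ _ x<z = ⊥-elim (noAscent (ascent (s≤s z≤n) refl ez m<x x<z))

module _ {N : ℕ} where

  FinWord : ℕ → Set
  FinWord = Vec (Maybe (Fin N))

  letterℕ : Maybe (Fin N) → Maybe ℕ
  letterℕ = Maybe.map toℕ

  toℕWord : ∀ {k} → FinWord k → ℕWord k
  toℕWord = Vec.map letterℕ

  OccursOnceIn : ∀ {k} → FinWord k → Maybe (Fin N) → Set
  OccursOnceIn {k} w y = Σ (Fin k) λ i → (lookup w i ≡ y) × (∀ j → lookup w j ≡ y → j ≡ i)

  sameLetter-≢ : ∀ {y z : Maybe (Fin N)} → y ≢ z → sameLetter (letterℕ y) (letterℕ z) ≡ 0
  sameLetter-≢ {nothing} {nothing} y≢z = ⊥-elim (y≢z refl)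
  sameLetter-≢ {nothing} {just _}  _   = refl
  sameLetter-≢ {just _}  {nothing} _   = refl
  sameLetter-≢ {just a}  {just b}  y≢z = ind-≡ᵇ-≢ (λ eq → y≢z (cong just (Fin.toℕ-injective eq)))

  multiplicity≡0 : ∀ {k} (w : FinWord k) y → (∀ j → lookup w j ≢ y) → multiplicity (letterℕ y) (toℕWord w) ≡ 0
  multiplicity≡0 []      y absent = refl
  multiplicity≡0 (z ∷ w) y absent = cong₂ _+_ (sameLetter-≢ (absent zero ∘ sym)) (multiplicity≡0 w y (absent ∘ suc))

  multiplicity≡0⇒absent : ∀ {k} (w : FinWord k) y → multiplicity (letterℕ y) (toℕWord w) ≡ 0 → ∀ j → lookup w j ≢ y
  multiplicity≡0⇒absent (z ∷ w) y eq zero    refl =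
    1+n≢0 (trans (sym (multiplicity-∷-self (letterℕ z) (toℕWord w))) eq)
  multiplicity≡0⇒absent (z ∷ w) y eq (suc j)      =
    multiplicity≡0⇒absent w y (m+n≡0⇒n≡0 (sameLetter (letterℕ y) (letterℕ z)) eq) j

  occursOnce⇒multiplicity≡1 : ∀ {k} (w : FinWord k) y → OccursOnceIn w y → multiplicity (letterℕ y) (toℕWord w) ≡ 1
  occursOnce⇒multiplicity≡1 (z ∷ w) y (zero , refl , unique) =
    cong₂ _+_ (sameLetter-refl (letterℕ z)) (multiplicity≡0 w z (λ j ez → Fin.0≢1+n (sym (unique (suc j) ez))))
  occursOnce⇒multiplicity≡1 (z ∷ w) y (suc i , ey , unique) =
    cong₂ _+_ (sameLetter-≢ (λ y≡z → Fin.0≢1+n (unique zero (sym y≡z))))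
              (occursOnce⇒multiplicity≡1 w y (i , ey , λ j ej → Fin.suc-injective (unique (suc j) ej)))

  multiplicity≡1⇒occursOnce : ∀ {k} (w : FinWord k) y → multiplicity (letterℕ y) (toℕWord w) ≡ 1 → OccursOnceIn w y
  multiplicity≡1⇒occursOnce (z ∷ w) y eq with Maybe.≡-dec Fin._≟_ z y
  ... | yes refl = zero , refl , unique
    where
    absent : multiplicity (letterℕ z) (toℕWord w) ≡ 0
    absent = suc-injective (trans (sym (multiplicity-∷-self (letterℕ z) (toℕWord w))) eq)
    unique : ∀ j → lookup (z ∷ w) j ≡ z → j ≡ zero
    unique zero    _  = refl
    unique (suc j) ej = ⊥-elim (multiplicity≡0⇒absent w z absent j ej)
  ... | no z≢y with multiplicity≡1⇒occursOnce w y (trans (sym (cong (_+ _) (sameLetter-≢ (z≢y ∘ sym)))) eq)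
  ...   | i , ei , unique = suc i , ei , unique′
    where
    unique′ : ∀ j → lookup (z ∷ w) j ≡ y → j ≡ suc i
    unique′ zero    ez = ⊥-elim (z≢y ez)
    unique′ (suc j) ej = cong suc (unique j ej)

  multiplicity-≥ : ∀ {k} (w : FinWord k) v → N ≤ v → multiplicity (just v) (toℕWord w) ≡ 0
  multiplicity-≥ []             v N≤v = refl
  multiplicity-≥ (nothing ∷ w)  v N≤v = multiplicity-≥ w v N≤v
  multiplicity-≥ (just a ∷ w)   v N≤v =
    cong₂ _+_ (ind-≡ᵇ-≢ (λ v≡a → <⇒≱ (subst (_< N) (sym v≡a) (Fin.toℕ<n a)) N≤v)) (multiplicity-≥ w v N≤v)

  IsPartialPermOf : ∀ {k} → FinWord k → Set
  IsPartialPermOf w = OccursOnceIn w nothing × (∀ v → OccursOnceIn w (just v))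

  partialPerm⇒usesExactly : ∀ {k} (w : FinWord k) → IsPartialPermOf w → UsesExactly N [] true (toℕWord w)
  partialPerm⇒usesExactly w (hole , occ) nothing  = occursOnce⇒multiplicity≡1 w nothing hole
  partialPerm⇒usesExactly w (hole , occ) (just v) with v <? N
  ... | yes v<N = begin
    multiplicity (just v) (toℕWord w)
      ≡⟨ cong (λ c → multiplicity (just c) (toℕWord w)) (Fin.toℕ-fromℕ< v<N) ⟨
    multiplicity (letterℕ (just (fromℕ< v<N))) (toℕWord w)
      ≡⟨ occursOnce⇒multiplicity≡1 w (just (fromℕ< v<N)) (occ (fromℕ< v<N)) ⟩
    1
      ≡⟨ trans (+-identityʳ _) (ind-<ᵇ v<N) ⟨
    ind (v <ᵇ N) + 0 ∎
  ... | no v≮N = trans (multiplicity-≥ w v (≮⇒≥ v≮N)) (sym (trans (+-identityʳ _) (ind-≮ᵇ (≮⇒≥ v≮N))))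

  usesExactly⇒partialPerm : ∀ {k} (w : FinWord k) → UsesExactly N [] true (toℕWord w) → IsPartialPermOf w
  usesExactly⇒partialPerm w uses =
    multiplicity≡1⇒occursOnce w nothing (uses nothing) ,
    λ a → multiplicity≡1⇒occursOnce w (just a)
            (trans (uses (just (toℕ a))) (trans (+-identityʳ _) (ind-<ᵇ (Fin.toℕ<n a))))

  lookup-toℕWord : ∀ {k} (w : FinWord k) a {x} → lookup w a ≡ just x → lookup (toℕWord w) a ≡ just (toℕ x)
  lookup-toℕWord w a ea = trans (lookup-map a letterℕ w) (cong letterℕ ea)

  lookup-toℕWord⁻ : ∀ {k} (w : FinWord k) a {x} → lookup (toℕWord w) a ≡ just x →
                    ∃ λ x′ → lookup w a ≡ just x′ × toℕ x′ ≡ x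
  lookup-toℕWord⁻ w a ea with lookup w a in ea′
  ... | just x′ = x′ , refl , Maybe.just-injective (trans (sym (lookup-toℕWord w a ea′)) ea)
  ... | nothing with trans (sym (trans (lookup-map a letterℕ w) (cong letterℕ ea′))) ea
  ...   | ()

  -- Letters ≥ N have no preimage and are sent to the hole; this never happens below,
  -- where the inverse is only applied to words over letters < N.
  fromℕLetter : Maybe ℕ → Maybe (Fin N)
  fromℕLetter nothing  = nothing
  fromℕLetter (just v) with v <? N
  ... | yes v<N = just (fromℕ< v<N)
  ... | no  _   = nothing

  fromℕWord : ∀ {k} → ℕWord k → FinWord k
  fromℕWord = Vec.map fromℕLetter

  fromℕLetter-just : ∀ {v} (v<N : v < N) → fromℕLetter (just v) ≡ just (fromℕ< v<N)
  fromℕLetter-just {v} v<N with v <? N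
  ... | yes _   = refl
  ... | no  v≮N = ⊥-elim (v≮N v<N)

  fromℕWord-toℕWord : ∀ {k} (w : FinWord k) → fromℕWord (toℕWord w) ≡ w
  fromℕWord-toℕWord []            = refl
  fromℕWord-toℕWord (nothing ∷ w) = cong (nothing ∷_) (fromℕWord-toℕWord w)
  fromℕWord-toℕWord (just a ∷ w)  =
    cong₂ _∷_ (trans (fromℕLetter-just (Fin.toℕ<n a)) (cong just (Fin.fromℕ<-toℕ a (Fin.toℕ<n a))))
              (fromℕWord-toℕWord w)

  toℕWord-fromℕWord : ∀ {k} (u : ℕWord k) → (∀ v → 0 < multiplicity (just v) u → v < N) → toℕWord (fromℕWord u) ≡ u
  toℕWord-fromℕWord []            _      = refl
  toℕWord-fromℕWord (nothing ∷ u) bounded = cong (nothing ∷_) (toℕWord-fromℕWord u bounded)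
  toℕWord-fromℕWord (just v ∷ u)  bounded =
    cong₂ _∷_ (trans (cong letterℕ (fromℕLetter-just v<N)) (cong just (Fin.toℕ-fromℕ< v<N)))
              (toℕWord-fromℕWord u (λ z p → bounded z (<-≤-trans p (m≤n+m _ (ind (z ≡ᵇ v))))))
    where
    v<N : v < N
    v<N = bounded v (subst (0 <_) (sym (multiplicity-∷-self (just v) u)) (s≤s z≤n))

usesExactly⇒letters< : ∀ {k N} (u : ℕWord k) → UsesExactly N [] true u → ∀ v → 0 < multiplicity (just v) u → v < N
usesExactly⇒letters< {N = N} u uses v p with v <? N
... | yes v<N = v<N
... | no  v≮N = ⊥-elim (<-irrefl (sym (trans (uses (just v)) (trans (+-identityʳ _) (ind-≮ᵇ (≮⇒≥ v≮N))))) p)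

-- Extensions of a partial permutation

countFin : ∀ {k} → (Fin k → Bool) → ℕ
countFin {zero}  P = 0
countFin {suc k} P = ind (P zero) + countFin (P ∘ suc)

length-filterᵇ-tabulate : ∀ {A : Set} {k} (P : A → Bool) (f : Fin k → A) →
                          length (filterᵇ P (List.tabulate f)) ≡ countFin (P ∘ f)
length-filterᵇ-tabulate {k = zero}  P f = refl
length-filterᵇ-tabulate {k = suc k} P f with P (f zero)
... | true  = cong suc (length-filterᵇ-tabulate P (f ∘ suc))
... | false = length-filterᵇ-tabulate P (f ∘ suc)

countFin-cong : ∀ {k} {P Q : Fin k → Bool} → (∀ j → P j ≡ Q j) → countFin P ≡ countFin Q
countFin-cong {zero}  eq = refl
countFin-cong {suc k} eq = cong₂ _+_ (cong ind (eq zero)) (countFin-cong (eq ∘ suc))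

ind-mono : ∀ {b c} → (T b → T c) → ind b ≤ ind c
ind-mono {false} _ = z≤n
ind-mono {true}  {true}  _ = ≤-refl
ind-mono {true}  {false} f = ⊥-elim (f _)

countFin-mono : ∀ {k} (P Q : Fin k → Bool) → (∀ j → T (P j) → T (Q j)) → countFin P ≤ countFin Q
countFin-mono {zero}  P Q P⊆Q = z≤n
countFin-mono {suc k} P Q P⊆Q = +-mono-≤ (ind-mono (P⊆Q zero)) (countFin-mono (P ∘ suc) (Q ∘ suc) (P⊆Q ∘ suc))

countFin-mono-< : ∀ {k} (P Q : Fin k → Bool) → (∀ j → T (P j) → T (Q j)) →
                  ∀ j₀ → T (Q j₀) → ¬ T (P j₀) → countFin P < countFin Q
countFin-mono-< P Q P⊆Q zero q ¬p with P zero | Q zero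
... | true  | _     = ⊥-elim (¬p _)
... | false | true  = s≤s (countFin-mono (P ∘ suc) (Q ∘ suc) (P⊆Q ∘ suc))
countFin-mono-< P Q P⊆Q (suc j₀) q ¬p =
  +-mono-≤-< (ind-mono (P⊆Q zero)) (countFin-mono-< (P ∘ suc) (Q ∘ suc) (P⊆Q ∘ suc) j₀ q ¬p)

isBelow : ℕ → Maybe ℕ → Bool
isBelow m nothing  = false
isBelow m (just v) = v <ᵇ m

lettersBelow : ∀ {k} → ℕ → ℕWord k → ℕ
lettersBelow m u = countFin (λ j → isBelow m (lookup u j))

lettersBelow-suc : ∀ {k} m (u : ℕWord k) → lettersBelow (suc m) u ≡ lettersBelow m u + multiplicity (just m) u
lettersBelow-suc m []            = refl
lettersBelow-suc m (nothing ∷ u) = lettersBelow-suc m u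
lettersBelow-suc m (just v ∷ u)  = begin
  ind (v <ᵇ suc m) + lettersBelow (suc m) u
    ≡⟨ cong₂ _+_ (ind-<ᵇ-suc v m) (lettersBelow-suc m u) ⟩
  ind (v <ᵇ m) + ind (v ≡ᵇ m) + (lettersBelow m u + multiplicity (just m) u)
    ≡⟨ cong (λ c → ind (v <ᵇ m) + c + _) (ind-≡ᵇ-sym v m) ⟩
  ind (v <ᵇ m) + ind (m ≡ᵇ v) + (lettersBelow m u + multiplicity (just m) u)
    ≡⟨ interchange (ind (v <ᵇ m)) (ind (m ≡ᵇ v)) (lettersBelow m u) (multiplicity (just m) u) ⟩
  ind (v <ᵇ m) + lettersBelow m u + (ind (m ≡ᵇ v) + multiplicity (just m) u) ∎

lettersBelow-perm : ∀ {k N} (u : ℕWord k) → UsesExactly N [] true u → ∀ m → m ≤ N → lettersBelow m u ≡ m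
lettersBelow-perm u uses zero    _   = lettersBelow-zero u
  where
  lettersBelow-zero : ∀ {k} (u : ℕWord k) → lettersBelow 0 u ≡ 0
  lettersBelow-zero []            = refl
  lettersBelow-zero (nothing ∷ u) = lettersBelow-zero u
  lettersBelow-zero (just v ∷ u)  = lettersBelow-zero u
lettersBelow-perm {N = N} u uses (suc m) m<N = begin
  lettersBelow (suc m) u                     ≡⟨ lettersBelow-suc m u ⟩
  lettersBelow m u + multiplicity (just m) u ≡⟨ cong₂ _+_ (lettersBelow-perm u uses m (<⇒≤ m<N)) (uses (just m)) ⟩
  m + (ind (m <ᵇ N) + 0)                     ≡⟨ cong (m +_) (trans (+-identityʳ _) (ind-<ᵇ m<N)) ⟩
  m + 1                                      ≡⟨ +-comm m 1 ⟩
  suc m                                      ∎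

<ᵇ-cong : ∀ {a b c d} → (a < b → c < d) → (c < d → a < b) → (a <ᵇ b) ≡ (c <ᵇ d)
<ᵇ-cong {a} {b} {c} {d} f g with a <ᵇ b in e₁ | c <ᵇ d in e₂
... | true  | true  = refl
... | false | false = refl
... | true  | false = ⊥-elim (subst T e₂ (<⇒<ᵇ (f (<ᵇ⇒< a b (subst T (sym e₁) _)))))
... | false | true  = ⊥-elim (subst T e₁ (<⇒<ᵇ (g (<ᵇ⇒< c d (subst T (sym e₂) _)))))

module _ {N : ℕ} (w : Word (suc N)) where

  private
    belowUnder : (σ : Permutation′ (suc N)) → Fin (suc N) → Fin (suc N) → Bool
    belowUnder σ i j = is-just (lookup w j) ∧ (toℕ (σ ⟨$⟩ʳ j) <ᵇ toℕ (σ ⟨$⟩ʳ i))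

    rank≡countFin : ∀ σ i → rankAmongNonHoles w σ i ≡ countFin (belowUnder σ i)
    rank≡countFin σ i = length-filterᵇ-tabulate (belowUnder σ i) (λ j → j)

  MatchesLetterOrder : Permutation′ (suc N) → Set
  MatchesLetterOrder σ = ∀ i j {v v′} → lookup w i ≡ just v → lookup w j ≡ just v′ →
                         (σ ⟨$⟩ʳ j Fin.< σ ⟨$⟩ʳ i) ⇔ (v′ Fin.< v)

  orderMatching⇒extension : IsPartialPermOf w → (σ : Permutation′ (suc N)) → MatchesLetterOrder σ → IsExtension σ w
  orderMatching⇒extension pp σ matching i v ei = sym (begin
    rankAmongNonHoles w σ i          ≡⟨ rank≡countFin σ i ⟩
    countFin (belowUnder σ i)        ≡⟨ countFin-cong pointwise ⟩
    lettersBelow (toℕ v) (toℕWord w) ≡⟨ lettersBelow-perm (toℕWord w) uses (toℕ v) (<⇒≤ (Fin.toℕ<n v)) ⟩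
    toℕ v                            ∎)
    where
    pointwise : ∀ j → belowUnder σ i j ≡ isBelow (toℕ v) (lookup (toℕWord w) j)
    pointwise j rewrite lookup-map j letterℕ w with lookup w j in ej
    ... | nothing = refl
    ... | just v′ = <ᵇ-cong (Equivalence.to (matching i j ei ej)) (Equivalence.from (matching i j ei ej))
    uses = partialPerm⇒usesExactly w pp

  extension-reflects-< : (σ : Permutation′ (suc N)) → IsExtension σ w → ∀ p q {x y} →
    lookup w p ≡ just x → lookup w q ≡ just y → σ ⟨$⟩ʳ p Fin.< σ ⟨$⟩ʳ q → x Fin.< y
  extension-reflects-< σ ext p q {x} {y} ep eq σp<σq =
    subst₂ _<_ (sym (trans (ext p x ep) (rank≡countFin σ p))) (sym (trans (ext q y eq) (rank≡countFin σ q)))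
      (countFin-mono-< (belowUnder σ p) (belowUnder σ q) below-p⊆below-q p q-below-q p-not-below-p)
    where
    below-p⊆below-q : ∀ j → T (belowUnder σ p j) → T (belowUnder σ q j)
    below-p⊆below-q j with lookup w j
    ... | just _ = λ σj<σp → <⇒<ᵇ (<-trans (<ᵇ⇒< _ _ σj<σp) σp<σq)
    q-below-q : T (belowUnder σ q p)
    q-below-q rewrite ep = <⇒<ᵇ σp<σq
    p-not-below-p : ¬ T (belowUnder σ p p)
    p-not-below-p σp<σp rewrite ep = <-irrefl refl (<ᵇ⇒< (toℕ (σ ⟨$⟩ʳ p)) _ σp<σp)

punchIn-mono-< : ∀ {n} (i : Fin (suc n)) {j k : Fin n} → j Fin.< k → punchIn i j Fin.< punchIn i k
punchIn-mono-< i {j} {k} j<k =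
  Fin.≤∧≢⇒< (Fin.punchIn-mono-≤ i j k (<⇒≤ j<k)) (λ eq → Fin.<-irrefl (Fin.punchIn-injective i j k eq) j<k)

punchIn-cancel-< : ∀ {n} (i : Fin (suc n)) {j k : Fin n} → punchIn i j Fin.< punchIn i k → j Fin.< k
punchIn-cancel-< i {j} {k} ij<ik =
  Fin.≤∧≢⇒< (Fin.punchIn-cancel-≤ i j k (<⇒≤ ij<ik)) (λ j≡k → Fin.<-irrefl (cong (punchIn i) j≡k) ij<ik)

<-punchIn : ∀ {n} (i : Fin (suc n)) (j : Fin n) → toℕ i ≤ toℕ j → i Fin.< punchIn i j
<-punchIn zero    j       _         = s≤s z≤n
<-punchIn (suc i) (suc j) (s≤s i≤j) = s≤s (<-punchIn i j i≤j)

punchIn-< : ∀ {n} (i : Fin (suc n)) (j : Fin n) → toℕ j < toℕ i → punchIn i j Fin.< i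
punchIn-< (suc i) zero    _         = s≤s z≤n
punchIn-< (suc i) (suc j) (s≤s j<i) = s≤s (punchIn-< i j j<i)

module Fill {N : ℕ} (w : Word (suc N)) (pp : IsPartialPermOf w) (t : Fin (suc N)) where

  value : Maybe (Fin N) → Fin (suc N)
  value nothing  = t
  value (just v) = punchIn t v

  private
    hole : Fin (suc N)
    hole = proj₁ (proj₁ pp)

    position : Fin N → Fin (suc N)
    position v = proj₁ (proj₂ pp v)

    to : Fin (suc N) → Fin (suc N)
    to p = value (lookup w p)

    from : Fin (suc N) → Fin (suc N)
    from y with t Fin.≟ y
    ... | yes _   = hole
    ... | no  t≢y = position (punchOut t≢y)

    to∘from : ∀ y → to (from y) ≡ y
    to∘from y with t Fin.≟ y
    ... | yes t≡y = trans (cong value (proj₁ (proj₂ (proj₁ pp)))) t≡y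
    ... | no  t≢y = trans (cong value (proj₁ (proj₂ (proj₂ pp (punchOut t≢y))))) (Fin.punchIn-punchOut t≢y)

    from∘to : ∀ p → from (to p) ≡ p
    from∘to p with lookup w p in ep
    ... | nothing with t Fin.≟ t
    ...   | yes _   = sym (proj₂ (proj₂ (proj₁ pp)) p ep)
    ...   | no  t≢t = ⊥-elim (t≢t refl)
    from∘to p | just v with t Fin.≟ punchIn t v
    ...   | yes t≡tv = ⊥-elim (Fin.punchInᵢ≢i t v (sym t≡tv))
    ...   | no  t≢tv = trans (cong position (trans (Fin.punchOut-cong t refl) (Fin.punchOut-punchIn t)))
                             (sym (proj₂ (proj₂ (proj₂ pp v)) p ep))

  σ : Permutation′ (suc N)
  σ = permutation to from to∘from from∘to

  σ-extends : IsExtension σ w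
  σ-extends = orderMatching⇒extension w pp σ matching
    where
    matching : MatchesLetterOrder w σ
    matching i j ei ej rewrite ei | ej = mk⇔ (punchIn-cancel-< t) (punchIn-mono-< t)

module _ {N : ℕ} (w : Word (suc N)) (pp : IsPartialPermOf w) where

  private
    hole : Fin (suc N)
    hole = proj₁ (proj₁ pp)

    lookup-hole : lookup w hole ≡ nothing
    lookup-hole = proj₁ (proj₂ (proj₁ pp))

    letterAt : ∀ p → p ≢ hole → ∃ λ v → lookup w p ≡ just v
    letterAt p p≢hole with lookup w p in ep
    ... | just v  = v , refl
    ... | nothing = ⊥-elim (p≢hole (proj₂ (proj₂ (proj₁ pp)) p ep))

    hole≢letter : ∀ {p v} → lookup w p ≡ just v → hole ≢ p
    hole≢letter ep refl with trans (sym lookup-hole) ep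
    ... | ()

    after-hole : ∀ {p q} → p ≡ hole → p Fin.< q → q ≢ hole
    after-hole p≡hole p<q q≡hole = Fin.<-irrefl (trans p≡hole (sym q≡hole)) p<q

    noIncreasingTriple : (σ : Permutation′ (suc N)) → IsExtension σ w → ¬ Has123 (toℕWord w) →
                 ∀ {p q r} → p Fin.< q → q Fin.< r → σ ⟨$⟩ʳ p Fin.< σ ⟨$⟩ʳ q → σ ⟨$⟩ʳ q Fin.< σ ⟨$⟩ʳ r →
                 p ≢ hole → q ≢ hole → r ≢ hole → ⊥
    noIncreasingTriple σ ext no123 {p} {q} {r} p<q q<r σp<σq σq<σr p≢h q≢h r≢h =
      let x , ex = letterAt p p≢h
          y , ey = letterAt q q≢h
          z , ez = letterAt r r≢h
      in no123 (has123 p<q q<r (lookup-toℕWord w p ex) (lookup-toℕWord w q ey) (lookup-toℕWord w r ez)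
                 (extension-reflects-< w σ ext p q ex ey σp<σq) (extension-reflects-< w σ ext q r ey ez σq<σr))

    fill : Avoids1234 w → ∀ t {p₁ p₂ p₃ p₄ y₁ y₂ y₃ y₄} →
           lookup w p₁ ≡ y₁ → lookup w p₂ ≡ y₂ → lookup w p₃ ≡ y₃ → lookup w p₄ ≡ y₄ →
           p₁ Fin.< p₂ → p₂ Fin.< p₃ → p₃ Fin.< p₄ →
           Fill.value w pp t y₁ Fin.< Fill.value w pp t y₂ → Fill.value w pp t y₂ Fin.< Fill.value w pp t y₃ →
           Fill.value w pp t y₃ Fin.< Fill.value w pp t y₄ → ⊥
    fill avoids t refl refl refl refl o₁ o₂ o₃ v₁ v₂ v₃ =
      avoids (Fill.σ w pp t) (Fill.σ-extends w pp t) (_ , _ , _ , _ , o₁ , o₂ , o₃ , v₁ , v₂ , v₃)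

  avoids123⇒avoids1234 : ¬ Has123 (toℕWord w) → Avoids1234 w
  avoids123⇒avoids1234 no123 σ ext (i , j , k , l , i<j , j<k , k<l , σi<σj , σj<σk , σk<σl)
    with i Fin.≟ hole | j Fin.≟ hole | k Fin.≟ hole
  ... | yes i≡h | _       | _       =
    noIncreasingTriple σ ext no123 j<k k<l σj<σk σk<σl
      (after-hole i≡h i<j) (after-hole i≡h (Fin.<-trans i<j j<k))
      (after-hole i≡h (Fin.<-trans i<j (Fin.<-trans j<k k<l)))
  ... | no i≢h  | yes j≡h | _       =
    noIncreasingTriple σ ext no123 (Fin.<-trans i<j j<k) k<l (Fin.<-trans σi<σj σj<σk) σk<σl
      i≢h (after-hole j≡h j<k) (after-hole j≡h (Fin.<-trans j<k k<l))
  ... | no i≢h  | no j≢h  | yes k≡h =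
    noIncreasingTriple σ ext no123 i<j (Fin.<-trans j<k k<l) σi<σj (Fin.<-trans σj<σk σk<σl)
      i≢h j≢h (after-hole k≡h k<l)
  ... | no i≢h  | no j≢h  | no k≢h  =
    noIncreasingTriple σ ext no123 i<j j<k σi<σj σj<σk i≢h j≢h k≢h

  avoids1234⇒avoids123 : Avoids1234 w → ¬ Has123 (toℕWord w)
  avoids1234⇒avoids123 avoids (has123 {a} {b} {c} a<b b<c ea eb ec x<y y<z)
    with lookup-toℕWord⁻ w a ea | lookup-toℕWord⁻ w b eb | lookup-toℕWord⁻ w c ec
  ... | x , ea′ , refl | y , eb′ , refl | z , ec′ , refl with Fin.<-cmp hole a
  ...   | tri≈ _ h≡a _ = hole≢letter ea′ h≡a
  ...   | tri< h<a _ _ = fill avoids zero lookup-hole ea′ eb′ ec′ h<a a<b b<c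
                           (<-punchIn zero x z≤n) (punchIn-mono-< zero x<y) (punchIn-mono-< zero y<z)
  ...   | tri> _ _ a<h with Fin.<-cmp hole b
  ...     | tri≈ _ h≡b _ = hole≢letter eb′ h≡b
  ...     | tri< h<b _ _ = fill avoids (suc x) ea′ lookup-hole eb′ ec′ a<h h<b b<c
                             (punchIn-< (suc x) x ≤-refl) (<-punchIn (suc x) y x<y) (punchIn-mono-< (suc x) y<z)
  ...     | tri> _ _ b<h with Fin.<-cmp hole c
  ...       | tri≈ _ h≡c _ = hole≢letter ec′ h≡c
  ...       | tri< h<c _ _ = fill avoids (suc y) ea′ eb′ lookup-hole ec′ a<b b<h h<c
                               (punchIn-mono-< (suc y) x<y) (punchIn-< (suc y) y ≤-refl) (<-punchIn (suc y) z y<z)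
  ...       | tri> _ _ c<h = fill avoids (Fin.fromℕ N) ea′ eb′ ec′ lookup-hole a<b b<c c<h
                               (punchIn-mono-< _ x<y) (punchIn-mono-< _ y<z)
                               (punchIn-< (Fin.fromℕ N) z (subst (toℕ z <_) (sym (Fin.toℕ-fromℕ N)) (Fin.toℕ<n z)))

module _ {N : ℕ} (w : Word (suc N)) (pp : IsPartialPermOf w) where

  private
    letters<N : ∀ j {z} → lookup (toℕWord w) j ≡ just z → z < N
    letters<N j ez with lookup-toℕWord⁻ w j ez
    ... | x , _ , refl = Fin.toℕ<n x

    distinct : Distinct (toℕWord w)
    distinct i j ei ej with lookup-toℕWord⁻ w i ei | lookup-toℕWord⁻ w j ej
    ... | x , ex , refl | y , ey , x≡y with Fin.toℕ-injective x≡y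
    ...   | refl = trans (proj₂ (proj₂ (proj₂ pp x)) i ex) (sym (proj₂ (proj₂ (proj₂ pp x)) j ey))

  admissible⇔avoids1234 : Admissible N (suc N) (toℕWord w) ⇔ Avoids1234 w
  admissible⇔avoids1234 = mk⇔
    (λ adm → avoids123⇒avoids1234 w pp (proj₁ (admissible⇒avoids N (suc N) (toℕWord w) adm (n≤1+n N))))
    (λ avoids → avoids⇒admissible N (suc N) (toℕWord w) (avoids1234⇒avoids123 w pp avoids)
       (λ { (ascent _ ey _ N<y _) → <-asym N<y (letters<N _ ey) })
       (λ j ez → m<n⇒m<1+n (letters<N j ez)) (λ j ez z≡N → <-irrefl z≡N (letters<N j ez)) distinct)

module _ {N : ℕ} where

  private
    initial : Pending N (suc N) []
    initial = record { descending = [] ; above = [] ; below = [] ; m<M = n<1+n N }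

    size : toWrite N [] true ≡ suc N
    size = trans (+-comm (N + 0) 1) (cong suc (+-identityʳ N))

  avoiders-sound₀ : ∀ u → u ∈ avoiders (suc N) N [] true → UsesExactly N [] true u × Admissible N (suc N) u
  avoiders-sound₀ = avoiders-sound (suc N) N (suc N) [] true initial size

  avoiders-complete₀ : ∀ u → UsesExactly N [] true u → Admissible N (suc N) u → u ∈ avoiders (suc N) N [] true
  avoiders-complete₀ = avoiders-complete (suc N) N (suc N) [] true initial size

∈avoiders⇔avoidingPartialPerm : ∀ {N} (w : Word (suc N)) →
  toℕWord w ∈ avoiders (suc N) N [] true ⇔ (IsPartialPerm1 w × Avoids1234 w)
∈avoiders⇔avoidingPartialPerm w = mk⇔
  (λ w∈ → let uses , adm = avoiders-sound₀ (toℕWord w) w∈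
              pp = usesExactly⇒partialPerm w uses
          in pp , Equivalence.to (admissible⇔avoids1234 w pp) adm)
  (λ (pp , avoids) → avoiders-complete₀ (toℕWord w)
                       (partialPerm⇒usesExactly w pp) (Equivalence.from (admissible⇔avoids1234 w pp) avoids))

avoidingPartialPerms : ∀ N → List (Word (suc N))
avoidingPartialPerms N = List.map fromℕWord (avoiders (suc N) N [] true)

toℕWord-avoidingPartialPerms : ∀ N → List.map toℕWord (avoidingPartialPerms N) ≡ avoiders (suc N) N [] true
toℕWord-avoidingPartialPerms N = trans (sym (map-∘ (avoiders (suc N) N [] true)))
  (map-id-local (All.tabulate λ {u} u∈ → toℕWord-fromℕWord u
    (usesExactly⇒letters< u (proj₁ (avoiders-sound₀ u u∈)))))

∈-avoidingPartialPerms : ∀ {N} (w : Word (suc N)) →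
  w ∈ avoidingPartialPerms N ⇔ toℕWord w ∈ avoiders (suc N) N [] true
∈-avoidingPartialPerms {N} w = mk⇔
  (λ w∈ → subst (toℕWord w ∈_) (toℕWord-avoidingPartialPerms N) (∈-map⁺ toℕWord w∈))
  (λ w∈ → subst (_∈ avoidingPartialPerms N) (fromℕWord-toℕWord w) (∈-map⁺ fromℕWord w∈))

avoidingPartialPerms-unique : ∀ N → Unique (avoidingPartialPerms N)
avoidingPartialPerms-unique N = Unique.map⁻ (subst Unique (sym (toℕWord-avoidingPartialPerms N))
  (avoiders-unique (suc N) N [] true []))

length-avoidingPartialPerms : ∀ N → length (avoidingPartialPerms N) ≡ (N + N) C N
length-avoidingPartialPerms N = begin
  length (avoidingPartialPerms N)             ≡⟨ length-map fromℕWord (avoiders (suc N) N [] true) ⟩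
  length (avoiders (suc N) N [] true)         ≡⟨ length-avoiders (suc N) N [] true ⟩
  #avoiders (suc N) N 0 true                  ≡⟨ #avoiders-hole N N 0 (+-identityʳ N) ⟩
  suc N * #avoiders N N 0 false               ≡⟨ [1+N]*#avoiders≡[2N]CN N ⟩
  (N + N) C N                                 ∎

theorem30 : (n : ℕ) → 1 ≤ n →
    ∃ λ (L : List (Word n)) →
    Unique L ×
    (∀ (w : Word n) → (w ∈ L) ⇔ (IsPartialPerm1 w × Avoids1234 w)) ×
    length L ≡ (2 * n ∸ 2) C (n ∸ 1)
theorem30 (suc N) _ =
  avoidingPartialPerms N ,
  avoidingPartialPerms-unique N ,
  (λ w → ∈avoiders⇔avoidingPartialPerm w ⇔-∘ ∈-avoidingPartialPerms w) ,
  trans (length-avoidingPartialPerms N) (cong (_C N) (sym (2[1+N]∸2≡N+N N)))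
  where
  2[1+N]∸2≡N+N : ∀ N → 2 * suc N ∸ 2 ≡ N + N
  2[1+N]∸2≡N+N N = cong (_∸ 2) (lemma N)
    where
    lemma : ∀ N → 2 * suc N ≡ 2 + (N + N)
    lemma = solve-∀
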